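{- Let $\mathcal{G}$ be a minor-closed family of graphs and let $c'(\mathcal{G})$ be a constant such that every graph $K\in\mathcal{G}$ satisfies $|E(K)|\le c'(\mathcal{G})|V(K)|$. If the primal-dual algorithm with reverse-delete described in the context is run on a graph $G\in\mathcal{G}$ with costs $c:V\to\mathbb{R}_{\ge0}$, then for each iteration $i$, with $W_i=Y-X_{i-1}$, $$\sum_{u\in A_i}|W_i\cap\Gamma^+(u)|\le|A_i\cap W_i|+c'(\mathcal{G})\left(|A_i|+3|W_i|\right).$$
   Context: $\Gamma(v)$ is the neighbor set of $v$ and $\Gamma^+(v)=\Gamma(v)\cup\{v\}$; a set $D$ is dominating if $D\cap\Gamma^+(v)\neq\emptyset$ for all $v$. Primal-dual algorithm: start with $X_0=\{v:c(v)=0\}$ and $y(v)=0$ for all $v$. In iteration $i=1,2,\dots$: let $A_i=\{v\in V: X_{i-1}\cap\Gamma^+(v)=\emptyset\}$. If $A_i=\emptyset$, stop and set $X=X_{i-1}$. Otherwise increase all $y(a)$, $a\in A_i$, uniformly until for some vertex $v$ the constraint $\sum_{u\in\Gamma^+(v)}y(u)\le c(v)$ becomes tight; let $X_i$ be $X_{i-1}$ together with all vertices whose constraint is tight. Reverse-delete: set $Y=X$ and consider the vertices of $X$ in the reverse of the order in which they were added to $X$ (a fixed linear order consistent with the iterations); for the current vertex $v$, if $Y-v$ is a dominating set, remove $v$ from $Y$. A family is minor-closed if it is closed under taking minors (in particular under taking subgraphs).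
   Formalization: The costs c and the constant $c'(\mathcal{G})$ are rational rather than real. -}

module Defs where

open import Data.Nat as ℕ using (ℕ; zero; suc)
open import Data.Integer using (+_)
open import Data.Fin as F using (Fin; toℕ)
open import Data.Fin.Subset using (Subset; _∈_; _∉_; _∩_; _∪_; _-_; ∣_∣; Nonempty; Empty)
open import Data.Bool using (Bool; true; false; _∧_; _∨_; not; if_then_else_)
open import Data.Vec using (tabulate; lookup)
open import Data.List as L using (List; []; _∷_; length; reverse)
open import Data.List.Membership.Propositional using () renaming (_∈_ to _∈ₗ_)
open import Data.List.Relation.Unary.Unique.Propositional using (Unique)
open import Data.Rational as Q using (ℚ; 0ℚ)
open import Data.Product using (Σ; ∃; _×_; _,_)
open import Data.Sum using (_⊎_)
open import Function using (_⇔_)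
open import Relation.Binary.PropositionalEquality using (_≡_)
open import Relation.Nullary.Decidable using (⌊_⌋)

record Graph : Set where
  field
    n     : ℕ
    adj   : Fin n → Fin n → Bool
    sym   : ∀ u v → adj u v ≡ adj v u
    loopless : ∀ v → adj v v ≡ false
open Graph public

sumℕ : ∀ {m} → (Fin m → ℕ) → ℕ
sumℕ {zero}  f = 0
sumℕ {suc m} f = f F.zero ℕ.+ sumℕ (λ i → f (F.suc i))

sumℚ : ∀ {m} → (Fin m → ℚ) → ℚ
sumℚ {zero}  f = 0ℚ
sumℚ {suc m} f = f F.zero Q.+ sumℚ (λ i → f (F.suc i))

anyᵇ : ∀ {m} → (Fin m → Bool) → Bool
anyᵇ {zero}  f = false
anyᵇ {suc m} f = f F.zero ∨ anyᵇ (λ i → f (F.suc i))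

allᵇ : ∀ {m} → (Fin m → Bool) → Bool
allᵇ {zero}  f = true
allᵇ {suc m} f = f F.zero ∧ allᵇ (λ i → f (F.suc i))

numV : Graph → ℕ
numV G = n G

numE : Graph → ℕ
numE G = sumℕ (λ u → sumℕ (λ v →
  if (toℕ u ℕ.<ᵇ toℕ v) ∧ adj G u v then 1 else 0))

toℚ : ℕ → ℚ
toℚ k = + k Q./ 1

-- Minors, via branch sets (models): H is a minor of G iff there are
-- nonempty, pairwise disjoint, connected vertex sets φ h ⊆ V(G), one for
-- each vertex h of H, such that adjacent vertices of H have adjacent
-- branch sets.

data WalkIn (G : Graph) (S : Subset (n G)) : Fin (n G) → Fin (n G) → Set where
  here : ∀ {u} → u ∈ S → WalkIn G S u u
  step : ∀ {u v w} → u ∈ S → adj G u v ≡ true → WalkIn G S v w → WalkIn G S u w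

ConnectedIn : (G : Graph) → Subset (n G) → Set
ConnectedIn G S = ∀ u v → u ∈ S → v ∈ S → WalkIn G S u v

IsMinor : Graph → Graph → Set
IsMinor H G =
  Σ (Fin (n H) → Subset (n G)) λ φ →
      (∀ h → Nonempty (φ h))
    × (∀ h h' → (h ≡ h' → Data.Empty.⊥) → Empty (φ h ∩ φ h'))
    × (∀ h → ConnectedIn G (φ h))
    × (∀ h h' → adj H h h' ≡ true →
         ∃ λ u → ∃ λ v → u ∈ φ h × v ∈ φ h' × adj G u v ≡ true)
  where import Data.Empty

MinorClosed : (Graph → Set) → Set
MinorClosed 𝒢 = ∀ G H → 𝒢 G → IsMinor H G → 𝒢 H

Γ⁺ : (G : Graph) → Fin (n G) → Subset (n G)
Γ⁺ G v = tabulate (λ u → ⌊ u F.≟ v ⌋ ∨ adj G u v)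

dominatingᵇ : (G : Graph) → Subset (n G) → Bool
dominatingᵇ G D = allᵇ (λ v → anyᵇ (λ u → lookup D u ∧ lookup (Γ⁺ G v) u))

-- A_i computed from X_{i-1}: vertices v with X_{i-1} ∩ Γ⁺(v) = ∅
active : (G : Graph) → Subset (n G) → Subset (n G)
active G X = tabulate (λ v → not (anyᵇ (λ u → lookup X u ∧ lookup (Γ⁺ G v) u)))

load : (G : Graph) → (Fin (n G) → ℚ) → Fin (n G) → ℚ
load G y v = sumℚ (λ u → if lookup (Γ⁺ G v) u then y u else 0ℚ)

AddedAt : ∀ {m} → (ℕ → Subset m) → Fin m → ℕ → Set
AddedAt X v i = v ∈ X i × (∀ j → j ℕ.< i → v ∉ X j)

reverseDelete : (G : Graph) → List (Fin (n G)) → Subset (n G) → Subset (n G)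
reverseDelete G []       Y = Y
reverseDelete G (v ∷ vs) Y =
  if dominatingᵇ G (Y - v) then reverseDelete G vs (Y - v)
                           else reverseDelete G vs Y

-- X i is X_i, y i is the dual vector after iteration i,
-- iterations 1..k have A_i ≠ ∅ and iteration k+1 stops (A_{k+1} = ∅),
-- so X = X_k.  ord lists X in a linear order consistent with the
-- iterations (order of addition).
record Run (G : Graph) (c : Fin (n G) → ℚ) : Set where
  field
    k   : ℕ
    X   : ℕ → Subset (n G)
    y   : ℕ → Fin (n G) → ℚ
    X₀  : ∀ v → (v ∈ X 0) ⇔ (c v ≡ 0ℚ)
    y₀  : ∀ v → y 0 v ≡ 0ℚ
    iter : ∀ i → i ℕ.< k →
        Nonempty (active G (X i))
      × (Σ ℚ λ δ → (0ℚ Q.< δ)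
          × (∀ u → u ∈ active G (X i) → y (suc i) u ≡ y i u Q.+ δ)
          × (∀ u → u ∉ active G (X i) → y (suc i) u ≡ y i u))
      × (∀ v → load G (y (suc i)) v Q.≤ c v)
      × (∃ λ v → (load G (y i) v Q.< c v) × (load G (y (suc i)) v ≡ c v))
      × (∀ v → (v ∈ X (suc i)) ⇔ (v ∈ X i ⊎ load G (y (suc i)) v ≡ c v))
    stop : Empty (active G (X k))
    ord  : List (Fin (n G))
    ord-unique : Unique ord
    ord-X : ∀ v → (v ∈ₗ ord) ⇔ (v ∈ X k)
    ord-consistent : ∀ (p q : Fin (length ord)) (i j : ℕ) →
      p F.< q → AddedAt X (L.lookup ord p) i → AddedAt X (L.lookup ord q) j →
      i ℕ.≤ j

  Yout : Subset (n G)
  Yout = reverseDelete G (reverse ord) (X k)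
open Run public

-- Write S = A ∪ W and e(S) for the number of edges of G inside S. Apart from the
-- diagonal terms u = v (which give |A ∩ W|), the left-hand side counts ordered
-- pairs (u, v) of adjacent vertices with u ∈ A and v ∈ W. An edge {u, v} is counted
-- at most once this way unless both of its ends lie in W, so the count is at most
-- e(S) + e(W). The induced subgraphs G[S] and G[W] are minors of G, whence
-- e(S) + e(W) ≤ c′ (|S| + |W|) ≤ c′ (|A| + 3 |W|). Nothing about the run of the
-- algorithm is used: the bound holds for any two vertex sets A and W.
module Submission where

open import Defs hiding (sym)
open import Data.Nat using (ℕ; suc; _≤_; _*_; _+_)
open import Data.Fin using (Fin)
open import Data.Fin.Subset using (_∩_; _─_; ∣_∣)
open import Data.Bool using (if_then_else_)
open import Data.Vec using (lookup)
open import Data.Rational as Q using (ℚ; 0ℚ)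

open import Data.Nat using (zero; _<_; _<ᵇ_; z≤n; s≤s)
import Data.Nat.Properties as ℕP
open import Data.Nat.Tactic.RingSolver using (solve-∀)
import Data.Integer as ℤ
import Data.Integer.Properties as ℤP
open import Data.Rational using (mkℚ)
import Data.Rational.Properties as QP
import Data.Nat.Coprimality as Coprimality
open import Data.Fin as F using (toℕ)
import Data.Fin.Properties as FP
open import Data.Fin.Subset using (Subset; _∪_; _∈_; ⁅_⁆; Nonempty; Empty)
import Data.Fin.Subset.Properties as SP
open import Data.Bool using (Bool; true; false; _∧_; _∨_; T)
open import Data.Bool.Properties using (∧-identityʳ; ∧-zeroʳ)
open import Data.Vec using (_∷_; [])
open import Data.Vec.Properties using (lookup-zipWith; lookup∘tabulate)
open import Data.Product using (∃; _×_; _,_)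
open import Data.Sum using (_⊎_; inj₁; inj₂)
open import Data.Empty using (⊥-elim)
open import Data.Unit using (tt)
open import Relation.Nullary using (yes; no)
open import Relation.Nullary.Decidable using (⌊_⌋)
open import Relation.Binary.PropositionalEquality
  using (_≡_; _≢_; refl; sym; trans; cong; cong₂; subst; module ≡-Reasoning)

private
  variable
    m : ℕ

ι : Bool → ℕ
ι b = if b then 1 else 0

sumℕ² : (Fin m → Fin m → ℕ) → ℕ
sumℕ² f = sumℕ λ u → sumℕ λ v → f u v

sumℕ-zero : ∀ m → sumℕ {m} (λ _ → 0) ≡ 0
sumℕ-zero zero    = refl
sumℕ-zero (suc m) = sumℕ-zero m

sumℕ-cong : {f g : Fin m → ℕ} → (∀ i → f i ≡ g i) → sumℕ f ≡ sumℕ g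
sumℕ-cong {zero}  f≡g = refl
sumℕ-cong {suc m} f≡g = cong₂ _+_ (f≡g F.zero) (sumℕ-cong (λ i → f≡g (F.suc i)))

sumℕ-mono-≤ : {f g : Fin m → ℕ} → (∀ i → f i ≤ g i) → sumℕ f ≤ sumℕ g
sumℕ-mono-≤ {zero}  f≤g = z≤n
sumℕ-mono-≤ {suc m} f≤g = ℕP.+-mono-≤ (f≤g F.zero) (sumℕ-mono-≤ (λ i → f≤g (F.suc i)))

sumℕ-+ : (f g : Fin m → ℕ) → sumℕ (λ i → f i + g i) ≡ sumℕ f + sumℕ g
sumℕ-+ {zero}  f g = refl
sumℕ-+ {suc m} f g = begin
  (f F.zero + g F.zero) + sumℕ (λ i → f (F.suc i) + g (F.suc i))
    ≡⟨ cong ((f F.zero + g F.zero) +_) (sumℕ-+ (λ i → f (F.suc i)) (λ i → g (F.suc i))) ⟩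
  (f F.zero + g F.zero) + (sumℕ (λ i → f (F.suc i)) + sumℕ (λ i → g (F.suc i)))
    ≡⟨ interchange (f F.zero) (g F.zero) _ _ ⟩
  sumℕ f + sumℕ g ∎
  where
  open ≡-Reasoning
  interchange : ∀ a b c d → (a + b) + (c + d) ≡ (a + c) + (b + d)
  interchange = solve-∀

sumℕ-if : (b : Bool) (f : Fin m → ℕ) →
  (if b then sumℕ f else 0) ≡ sumℕ (λ i → if b then f i else 0)
sumℕ-if     true  f = refl
sumℕ-if {m} false f = sym (sumℕ-zero m)

sumℕ-δ : (f : Fin m → ℕ) (u : Fin m) → sumℕ (λ v → if ⌊ v F.≟ u ⌋ then f v else 0) ≡ f u
sumℕ-δ {suc m} f F.zero    = trans (cong (f F.zero +_) (sumℕ-zero m)) (ℕP.+-identityʳ (f F.zero))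
sumℕ-δ {suc m} f (F.suc u) = trans (sumℕ-cong {m} λ v → cong (λ b → if b then f (F.suc v) else 0) (⌊suc≟suc⌋ v))
                                    (sumℕ-δ (λ v → f (F.suc v)) u)
  where
  ⌊suc≟suc⌋ : ∀ v → ⌊ F.suc v F.≟ F.suc u ⌋ ≡ ⌊ v F.≟ u ⌋
  ⌊suc≟suc⌋ v with v F.≟ u
  ... | yes _ = refl
  ... | no  _ = refl

sumℕ-comm : ∀ {k l} (f : Fin k → Fin l → ℕ) →
  sumℕ (λ u → sumℕ (λ v → f u v)) ≡ sumℕ (λ v → sumℕ (λ u → f u v))
sumℕ-comm {zero}  {l} f = sym (sumℕ-zero l)
sumℕ-comm {suc k}     f = begin
  sumℕ (f F.zero) + sumℕ (λ u → sumℕ (λ v → f (F.suc u) v))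
    ≡⟨ cong (sumℕ (f F.zero) +_) (sumℕ-comm (λ u → f (F.suc u))) ⟩
  sumℕ (f F.zero) + sumℕ (λ v → sumℕ (λ u → f (F.suc u) v))
    ≡⟨ sumℕ-+ (f F.zero) _ ⟨
  sumℕ (λ v → sumℕ (λ u → f u v)) ∎
  where open ≡-Reasoning

sumℕ²-+ : (f g : Fin m → Fin m → ℕ) → sumℕ² (λ u v → f u v + g u v) ≡ sumℕ² f + sumℕ² g
sumℕ²-+ f g = trans (sumℕ-cong λ u → sumℕ-+ (f u) (g u))
                    (sumℕ-+ (λ u → sumℕ (f u)) (λ u → sumℕ (g u)))

sumℕ²-mono-symmetrised : {f g : Fin m → Fin m → ℕ} →
  (∀ u v → f u v + f v u ≤ g u v + g v u) → sumℕ² f ≤ sumℕ² g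
sumℕ²-mono-symmetrised {f = f} {g} fᵀ≤gᵀ =
  ℕP.≮⇒≥ λ g<f → ℕP.<⇒≱ (ℕP.+-mono-< g<f g<f) (begin
    sumℕ² f + sumℕ² f                   ≡⟨ cong (sumℕ² f +_) (sumℕ-comm f) ⟩
    sumℕ² f + sumℕ² (λ u v → f v u)     ≡⟨ sumℕ²-+ f (λ u v → f v u) ⟨
    sumℕ² (λ u v → f u v + f v u)       ≤⟨ sumℕ-mono-≤ (λ u → sumℕ-mono-≤ (fᵀ≤gᵀ u)) ⟩
    sumℕ² (λ u v → g u v + g v u)       ≡⟨ sumℕ²-+ g (λ u v → g v u) ⟩
    sumℕ² g + sumℕ² (λ u v → g v u)     ≡⟨ cong (sumℕ² g +_) (sumℕ-comm g) ⟨
    sumℕ² g + sumℕ² g                   ∎)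
  where open ℕP.≤-Reasoning

∣p∣≡sumℕ : (p : Subset m) → ∣ p ∣ ≡ sumℕ (λ v → ι (lookup p v))
∣p∣≡sumℕ []          = refl
∣p∣≡sumℕ (true ∷ p)  = cong suc (∣p∣≡sumℕ p)
∣p∣≡sumℕ (false ∷ p) = ∣p∣≡sumℕ p

∣p∪q∣≤∣p∣+∣q∣ : (p q : Subset m) → ∣ p ∪ q ∣ ≤ ∣ p ∣ + ∣ q ∣
∣p∪q∣≤∣p∣+∣q∣ []          []          = z≤n
∣p∪q∣≤∣p∣+∣q∣ (true ∷ p)  (true ∷ q)  = s≤s (ℕP.≤-trans (∣p∪q∣≤∣p∣+∣q∣ p q) (ℕP.+-monoʳ-≤ ∣ p ∣ (ℕP.n≤1+n ∣ q ∣)))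
∣p∪q∣≤∣p∣+∣q∣ (true ∷ p)  (false ∷ q) = s≤s (∣p∪q∣≤∣p∣+∣q∣ p q)
∣p∪q∣≤∣p∣+∣q∣ (false ∷ p) (true ∷ q)  = ℕP.≤-trans (s≤s (∣p∪q∣≤∣p∣+∣q∣ p q)) (ℕP.≤-reflexive (sym (ℕP.+-suc ∣ p ∣ ∣ q ∣)))
∣p∪q∣≤∣p∣+∣q∣ (false ∷ p) (false ∷ q) = ∣p∪q∣≤∣p∣+∣q∣ p q

embed : (S : Subset m) → Fin ∣ S ∣ → Fin m
embed (true  ∷ S) F.zero    = F.zero
embed (true  ∷ S) (F.suc i) = F.suc (embed S i)
embed (false ∷ S) i         = F.suc (embed S i)

embed-injective : (S : Subset m) {i j : Fin ∣ S ∣} → embed S i ≡ embed S j → i ≡ j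
embed-injective (true  ∷ S) {F.zero}  {F.zero}  _  = refl
embed-injective (true  ∷ S) {F.suc i} {F.suc j} eq = cong F.suc (embed-injective S (FP.suc-injective eq))
embed-injective (false ∷ S)                     eq = embed-injective S (FP.suc-injective eq)

embed-<ᵇ : (S : Subset m) (i j : Fin ∣ S ∣) →
  (toℕ (embed S i) <ᵇ toℕ (embed S j)) ≡ (toℕ i <ᵇ toℕ j)
embed-<ᵇ (true  ∷ S) F.zero    F.zero    = refl
embed-<ᵇ (true  ∷ S) F.zero    (F.suc j) = refl
embed-<ᵇ (true  ∷ S) (F.suc i) F.zero    = refl
embed-<ᵇ (true  ∷ S) (F.suc i) (F.suc j) = embed-<ᵇ S i j
embed-<ᵇ (false ∷ S) i         j         = embed-<ᵇ S i j

sumℕ-embed : (S : Subset m) (f : Fin m → ℕ) →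
  sumℕ (λ i → f (embed S i)) ≡ sumℕ (λ v → if lookup S v then f v else 0)
sumℕ-embed []          f = refl
sumℕ-embed (true  ∷ S) f = cong (f F.zero +_) (sumℕ-embed S (λ v → f (F.suc v)))
sumℕ-embed (false ∷ S) f = sumℕ-embed S (λ v → f (F.suc v))

induced : (G : Graph) → Subset (n G) → Graph
induced G S = record
  { n        = ∣ S ∣
  ; adj      = λ i j → adj G (embed S i) (embed S j)
  ; sym      = λ i j → Graph.sym G (embed S i) (embed S j)
  ; loopless = λ i → loopless G (embed S i)
  }

induced-isMinor : (G : Graph) (S : Subset (n G)) → IsMinor (induced G S) G
induced-isMinor G S = branch , nonempty , disjoint , connected , adjacent
  where
  branch : Fin ∣ S ∣ → Subset (n G)
  branch h = ⁅ embed S h ⁆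
  nonempty : ∀ h → Nonempty (branch h)
  nonempty h = embed S h , SP.x∈⁅x⁆ (embed S h)
  disjoint : ∀ h h′ → h ≢ h′ → Empty (branch h ∩ branch h′)
  disjoint h h′ h≢h′ (u , u∈) with SP.x∈p∩q⁻ (branch h) (branch h′) u∈
  ... | u∈h , u∈h′ = h≢h′ (embed-injective S (trans (sym (SP.x∈⁅y⁆⇒x≡y _ u∈h)) (SP.x∈⁅y⁆⇒x≡y _ u∈h′)))
  connected : ∀ h → ConnectedIn G (branch h)
  connected h u v u∈ v∈ with SP.x∈⁅y⁆⇒x≡y _ u∈ | SP.x∈⁅y⁆⇒x≡y _ v∈
  ... | refl | refl = here u∈
  adjacent : ∀ h h′ → adj (induced G S) h h′ ≡ true →
    ∃ λ u → ∃ λ v → u ∈ branch h × v ∈ branch h′ × adj G u v ≡ true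
  adjacent h h′ e = embed S h , embed S h′ , SP.x∈⁅x⁆ _ , SP.x∈⁅x⁆ _ , e

edgeIndicator : (G : Graph) → Subset (n G) → Fin (n G) → Fin (n G) → ℕ
edgeIndicator G S u v = ι (((toℕ u <ᵇ toℕ v) ∧ adj G u v) ∧ (lookup S u ∧ lookup S v))

arcIndicator : (G : Graph) → Subset (n G) → Subset (n G) → Fin (n G) → Fin (n G) → ℕ
arcIndicator G A W u v = ι (adj G u v ∧ (lookup A u ∧ lookup W v))

edgesIn : (G : Graph) → Subset (n G) → ℕ
edgesIn G S = sumℕ² (edgeIndicator G S)

arcsFromTo : (G : Graph) → Subset (n G) → Subset (n G) → ℕ
arcsFromTo G A W = sumℕ² (arcIndicator G A W)

ι-guarded : ∀ a b x → (if a then (if b then ι x else 0) else 0) ≡ ι (x ∧ (a ∧ b))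
ι-guarded true  true  x = cong ι (sym (∧-identityʳ x))
ι-guarded true  false x = cong ι (sym (∧-zeroʳ x))
ι-guarded false b     x = cong ι (sym (∧-zeroʳ x))

numE-induced : (G : Graph) (S : Subset (n G)) → numE (induced G S) ≡ edgesIn G S
numE-induced G S = begin
  numE (induced G S)
    ≡⟨ sumℕ-cong (λ i → sumℕ-cong λ j → cong (λ b → ι (b ∧ adj G (embed S i) (embed S j))) (embed-<ᵇ S i j)) ⟨
  sumℕ (λ i → sumℕ λ j → ι (edge (embed S i) (embed S j)))
    ≡⟨ sumℕ-cong (λ i → sumℕ-embed S (λ v → ι (edge (embed S i) v))) ⟩
  sumℕ (λ i → sumℕ λ v → if lookup S v then ι (edge (embed S i) v) else 0)
    ≡⟨ sumℕ-embed S (λ u → sumℕ λ v → if lookup S v then ι (edge u v) else 0) ⟩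
  sumℕ (λ u → if lookup S u then sumℕ (λ v → if lookup S v then ι (edge u v) else 0) else 0)
    ≡⟨ sumℕ-cong (λ u → sumℕ-if (lookup S u) (λ v → if lookup S v then ι (edge u v) else 0)) ⟩
  sumℕ² (λ u v → if lookup S u then (if lookup S v then ι (edge u v) else 0) else 0)
    ≡⟨ sumℕ-cong (λ u → sumℕ-cong λ v → ι-guarded (lookup S u) (lookup S v) (edge u v)) ⟩
  edgesIn G S ∎
  where
  open ≡-Reasoning
  edge : Fin (n G) → Fin (n G) → Bool
  edge u v = (toℕ u <ᵇ toℕ v) ∧ adj G u v

edgesIn-bound : (𝒢 : Graph → Set) → MinorClosed 𝒢 →
  (c′ : ℚ) → (∀ K → 𝒢 K → toℚ (numE K) Q.≤ c′ Q.* toℚ (numV K)) →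
  (G : Graph) → 𝒢 G → (S : Subset (n G)) → toℚ (edgesIn G S) Q.≤ c′ Q.* toℚ ∣ S ∣
edgesIn-bound 𝒢 closed c′ sparse G G∈𝒢 S =
  subst (λ e → toℚ e Q.≤ c′ Q.* toℚ ∣ S ∣) (numE-induced G S)
        (sparse (induced G S) (closed G (induced G S) G∈𝒢 (induced-isMinor G S)))

closedNeighbourhood-term-≤ : ∀ a w p e →
  (if a then ι (w ∧ (p ∨ e)) else 0) ≤ (if p then ι (a ∧ w) else 0) + ι (e ∧ (a ∧ w))
closedNeighbourhood-term-≤ false w     p     e     = z≤n
closedNeighbourhood-term-≤ true  false p     e     = z≤n
closedNeighbourhood-term-≤ true  true  true  e     = s≤s z≤n
closedNeighbourhood-term-≤ true  true  false true  = ℕP.≤-refl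
closedNeighbourhood-term-≤ true  true  false false = z≤n

sum-closedNeighbourhoods-≤ : (G : Graph) (A W : Subset (n G)) →
  sumℕ (λ u → if lookup A u then ∣ W ∩ Γ⁺ G u ∣ else 0) ≤ ∣ A ∩ W ∣ + arcsFromTo G A W
sum-closedNeighbourhoods-≤ G A W = begin
  sumℕ (λ u → if lookup A u then ∣ W ∩ Γ⁺ G u ∣ else 0)
    ≡⟨ sumℕ-cong (λ u → trans (cong (λ k → if lookup A u then k else 0) (∣p∣≡sumℕ (W ∩ Γ⁺ G u)))
                               (sumℕ-if (lookup A u) (λ v → ι (lookup (W ∩ Γ⁺ G u) v)))) ⟩
  sumℕ² (λ u v → if lookup A u then ι (lookup (W ∩ Γ⁺ G u) v) else 0)
    ≤⟨ sumℕ-mono-≤ (λ u → sumℕ-mono-≤ (term-≤ u)) ⟩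
  sumℕ² (λ u v → diagonal u v + arcIndicator G A W u v)
    ≡⟨ sumℕ²-+ diagonal (arcIndicator G A W) ⟩
  sumℕ² diagonal + arcsFromTo G A W
    ≡⟨ cong (_+ arcsFromTo G A W) (sumℕ-cong λ u → sumℕ-δ (λ v → ι (lookup A u ∧ lookup W v)) u) ⟩
  sumℕ (λ u → ι (lookup A u ∧ lookup W u)) + arcsFromTo G A W
    ≡⟨ cong (_+ arcsFromTo G A W) (trans (∣p∣≡sumℕ (A ∩ W)) (sumℕ-cong λ u → cong ι (lookup-zipWith _∧_ u A W))) ⟨
  ∣ A ∩ W ∣ + arcsFromTo G A W ∎
  where
  open ℕP.≤-Reasoning
  diagonal : Fin (n G) → Fin (n G) → ℕ
  diagonal u v = if ⌊ v F.≟ u ⌋ then ι (lookup A u ∧ lookup W v) else 0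
  term-≤ : ∀ u v → (if lookup A u then ι (lookup (W ∩ Γ⁺ G u) v) else 0) ≤ diagonal u v + arcIndicator G A W u v
  term-≤ u v rewrite lookup-zipWith _∧_ v W (Γ⁺ G u)
                   | lookup∘tabulate (λ x → ⌊ x F.≟ u ⌋ ∨ adj G x u) v
                   | Graph.sym G v u
    = closedNeighbourhood-term-≤ (lookup A u) (lookup W v) ⌊ v F.≟ u ⌋ (adj G u v)

-- a, b (resp. c, d) say whether u (resp. v) lies in A, W: both arcs of an edge
-- {u, v} run from A to W only when u, v ∈ W.
arc-pair-≤ : ∀ a b c d → ι (a ∧ d) + ι (c ∧ b) ≤ ι ((a ∨ b) ∧ (c ∨ d)) + ι (b ∧ d)
arc-pair-≤ false b     false d     = z≤n
arc-pair-≤ false true  true  d     = s≤s z≤n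
arc-pair-≤ false false true  d     = z≤n
arc-pair-≤ true  b     false true  = s≤s z≤n
arc-pair-≤ true  b     false false = z≤n
arc-pair-≤ true  true  true  true  = ℕP.≤-refl
arc-pair-≤ true  true  true  false = s≤s z≤n
arc-pair-≤ true  false true  true  = s≤s z≤n
arc-pair-≤ true  false true  false = z≤n

<ᵇ≡true⇒< : ∀ {x y} → (x <ᵇ y) ≡ true → x < y
<ᵇ≡true⇒< {x} {y} eq = ℕP.<ᵇ⇒< x y (subst T (sym eq) tt)

<ᵇ≡false⇒≥ : ∀ {x y} → (x <ᵇ y) ≡ false → y ≤ x
<ᵇ≡false⇒≥ eq = ℕP.≮⇒≥ λ x<y → subst T eq (ℕP.<⇒<ᵇ x<y)

arcIndicator-pair-≤ : (G : Graph) (A W : Subset (n G)) (u v : Fin (n G)) →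
  arcIndicator G A W u v + arcIndicator G A W v u
    ≤ (edgeIndicator G (A ∪ W) u v + edgeIndicator G W u v)
      + (edgeIndicator G (A ∪ W) v u + edgeIndicator G W v u)
arcIndicator-pair-≤ G A W u v
  rewrite Graph.sym G v u | lookup-zipWith _∨_ u A W | lookup-zipWith _∨_ v A W
  with adj G u v in uv | toℕ u <ᵇ toℕ v in u<v | toℕ v <ᵇ toℕ u in v<u
... | false | _     | _     = z≤n
... | true  | true  | true  = ⊥-elim (ℕP.<-asym (<ᵇ≡true⇒< {toℕ u} u<v) (<ᵇ≡true⇒< {toℕ v} v<u))
... | true  | true  | false =
  ℕP.≤-trans (arc-pair-≤ (lookup A u) (lookup W u) (lookup A v) (lookup W v)) (ℕP.m≤m+n _ 0)
... | true  | false | true  =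
  ℕP.≤-trans (ℕP.≤-reflexive (ℕP.+-comm (ι (lookup A u ∧ lookup W v)) (ι (lookup A v ∧ lookup W u))))
             (arc-pair-≤ (lookup A v) (lookup W v) (lookup A u) (lookup W u))
... | true  | false | false = ⊥-elim (no-loop (FP.toℕ-injective (ℕP.≤-antisym (<ᵇ≡false⇒≥ {toℕ v} v<u) (<ᵇ≡false⇒≥ {toℕ u} u<v))))
  where
  no-loop : u ≢ v
  no-loop refl with () ← trans (sym uv) (loopless G u)

arcsFromTo-≤ : (G : Graph) (A W : Subset (n G)) → arcsFromTo G A W ≤ edgesIn G (A ∪ W) + edgesIn G W
arcsFromTo-≤ G A W =
  ℕP.≤-trans (sumℕ²-mono-symmetrised (arcIndicator-pair-≤ G A W))
             (ℕP.≤-reflexive (sumℕ²-+ (edgeIndicator G (A ∪ W)) (edgeIndicator G W)))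

toℚ-normal : ∀ k → toℚ k ≡ mkℚ (ℤ.+ k) 0 (Coprimality.sym (Coprimality.1-coprimeTo k))
toℚ-normal k = QP.normalize-coprime (Coprimality.sym (Coprimality.1-coprimeTo k))

toℚ-+ : ∀ a b → toℚ (a + b) ≡ toℚ a Q.+ toℚ b
toℚ-+ a b rewrite toℚ-normal a | toℚ-normal b =
  cong (Q._/ 1) (sym (cong₂ ℤ._+_ (ℤP.*-identityʳ (ℤ.+ a)) (ℤP.*-identityʳ (ℤ.+ b))))

toℚ-mono-≤ : ∀ {a b} → a ≤ b → toℚ a Q.≤ toℚ b
toℚ-mono-≤ {a} {b} a≤b rewrite toℚ-normal a | toℚ-normal b =
  Q.*≤* (ℤP.*-monoʳ-≤-nonNeg (ℤ.+ 1) (ℤ.+≤+ a≤b))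

toℚ-nonNeg : ∀ k → 0ℚ Q.≤ toℚ k
toℚ-nonNeg k = toℚ-mono-≤ {0} {k} z≤n

toℚ-suc-pos : ∀ k → 0ℚ Q.< toℚ (suc k)
toℚ-suc-pos k rewrite toℚ-normal (suc k) = QP.positive⁻¹ _

nonNeg⊎zero : ∀ c k → 0ℚ Q.≤ c Q.* toℚ k → 0ℚ Q.≤ c ⊎ k ≡ 0
nonNeg⊎zero c zero    _     = inj₂ refl
nonNeg⊎zero c (suc k) 0≤ck = inj₁ (QP.*-cancelʳ-≤-pos (toℚ (suc k)) {{Q.positive (toℚ-suc-pos k)}}
  (subst (Q._≤ c Q.* toℚ (suc k)) (sym (QP.*-zeroˡ (toℚ (suc k)))) 0≤ck))

-- If c′ < 0 the hypothesis forces A ∪ W = ∅, and then both sides vanish.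
*-toℚ-∪-≤ : (c′ : ℚ) (A W : Subset m) → 0ℚ Q.≤ c′ Q.* toℚ ∣ A ∪ W ∣ →
  c′ Q.* toℚ (∣ A ∪ W ∣ + ∣ W ∣) Q.≤ c′ Q.* toℚ (∣ A ∣ + 3 * ∣ W ∣)
*-toℚ-∪-≤ c′ A W 0≤c′s with nonNeg⊎zero c′ ∣ A ∪ W ∣ 0≤c′s
... | inj₁ 0≤c′ = QP.*-monoˡ-≤-nonNeg c′ {{Q.nonNegative 0≤c′}} (toℚ-mono-≤ (begin
  ∣ A ∪ W ∣ + ∣ W ∣       ≤⟨ ℕP.+-monoˡ-≤ ∣ W ∣ (∣p∪q∣≤∣p∣+∣q∣ A W) ⟩
  ∣ A ∣ + ∣ W ∣ + ∣ W ∣   ≤⟨ ℕP.m≤m+n _ ∣ W ∣ ⟩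
  ∣ A ∣ + ∣ W ∣ + ∣ W ∣ + ∣ W ∣ ≡⟨ regroup ∣ A ∣ ∣ W ∣ ⟩
  ∣ A ∣ + 3 * ∣ W ∣       ∎))
  where
  open ℕP.≤-Reasoning
  regroup : ∀ a w → a + w + w + w ≡ a + 3 * w
  regroup = solve-∀
... | inj₂ ∣A∪W∣≡0
  rewrite ℕP.n≤0⇒n≡0 (subst (∣ A ∣ ≤_) ∣A∪W∣≡0 (SP.∣p∣≤∣p∪q∣ A W))
        | ℕP.n≤0⇒n≡0 (subst (∣ W ∣ ≤_) ∣A∪W∣≡0 (SP.∣q∣≤∣p∪q∣ A W))
        | ∣A∪W∣≡0
  = QP.≤-refl

lemma3 : (𝒢 : Graph → Set) → MinorClosed 𝒢 →
    (c′ : ℚ) → (∀ K → 𝒢 K → toℚ (numE K) Q.≤ c′ Q.* toℚ (numV K)) →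
    (G : Graph) → 𝒢 G →
    (c : Fin (n G) → ℚ) → (∀ v → 0ℚ Q.≤ c v) →
    (R : Run G c) →
    (i : ℕ) → i ≤ k R →
    let W = Yout R ─ X R i
        A = active G (X R i)
    in toℚ (sumℕ (λ u → if lookup A u then ∣ W ∩ Γ⁺ G u ∣ else 0))
         Q.≤ toℚ ∣ A ∩ W ∣ Q.+ c′ Q.* toℚ (∣ A ∣ + 3 * ∣ W ∣)
lemma3 𝒢 closed c′ sparse G G∈𝒢 c _ R i _ = begin
  toℚ (sumℕ (λ u → if lookup A u then ∣ W ∩ Γ⁺ G u ∣ else 0))
    ≤⟨ toℚ-mono-≤ (ℕP.≤-trans (sum-closedNeighbourhoods-≤ G A W) (ℕP.+-monoʳ-≤ ∣ A ∩ W ∣ (arcsFromTo-≤ G A W))) ⟩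
  toℚ (∣ A ∩ W ∣ + (edgesIn G (A ∪ W) + edgesIn G W))
    ≡⟨ trans (toℚ-+ ∣ A ∩ W ∣ _) (cong (toℚ ∣ A ∩ W ∣ Q.+_) (toℚ-+ (edgesIn G (A ∪ W)) (edgesIn G W))) ⟩
  toℚ ∣ A ∩ W ∣ Q.+ (toℚ (edgesIn G (A ∪ W)) Q.+ toℚ (edgesIn G W))
    ≤⟨ QP.+-monoʳ-≤ (toℚ ∣ A ∩ W ∣) (QP.+-mono-≤ (bound (A ∪ W)) (bound W)) ⟩
  toℚ ∣ A ∩ W ∣ Q.+ (c′ Q.* toℚ ∣ A ∪ W ∣ Q.+ c′ Q.* toℚ ∣ W ∣)
    ≡⟨ cong (toℚ ∣ A ∩ W ∣ Q.+_) (trans (sym (QP.*-distribˡ-+ c′ _ _)) (cong (c′ Q.*_) (sym (toℚ-+ ∣ A ∪ W ∣ ∣ W ∣)))) ⟩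
  toℚ ∣ A ∩ W ∣ Q.+ c′ Q.* toℚ (∣ A ∪ W ∣ + ∣ W ∣)
    ≤⟨ QP.+-monoʳ-≤ (toℚ ∣ A ∩ W ∣) (*-toℚ-∪-≤ c′ A W (QP.≤-trans (toℚ-nonNeg (edgesIn G (A ∪ W))) (bound (A ∪ W)))) ⟩
  toℚ ∣ A ∩ W ∣ Q.+ c′ Q.* toℚ (∣ A ∣ + 3 * ∣ W ∣) ∎
  where
  open QP.≤-Reasoning
  W A : Subset (n G)
  W = Yout R ─ X R i
  A = active G (X R i)
  bound : (S : Subset (n G)) → toℚ (edgesIn G S) Q.≤ c′ Q.* toℚ ∣ S ∣
  bound = edgesIn-bound 𝒢 closed c′ sparse G G∈𝒢
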